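{- There is an algorithm which, given $N$ and oracle access to an appeasable uncertain comparator $\mathcal A$ over $\{1,\ldots,N\}$, outputs an element of the goal range of $\mathcal A$ with probability at least $2/3$, using $O(\log N)$ oracle calls.
   Context: An uncertain comparator over $\{1,\ldots,N\}$ is an oracle $\mathcal A$ to a probabilistic function from $\{1,\ldots,N\}$ to $\{\text{low},\text{good},\text{high}\}$ such that: (conviction) there exists a function $f:\{1,\ldots,N\}\to\{\text{low},\text{good},\text{high}\}$ such that for every $1\le i\le N$ and every event $E$ about past calls, $\Pr[\mathcal A(i)=f(i)\mid E]\ge 99/100$; (monotonicity) this $f$ is non-decreasing with respect to the order low $<$ good $<$ high. The goal range of $\mathcal A$ is $\{1\le i\le N:\Pr[\mathcal A(i)=\text{good}]\ge 99/100\}$. $\mathcal A$ is appeasable if its goal range is non-empty.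
   Formalization: The probabilities with which the uncertain comparator $\mathcal A$ answers low, good or high, after any history of past calls, are rational. -}

module Defs where

open import Data.Nat as ℕ using (ℕ; zero; suc; _⊔_)
open import Data.Nat.Logarithm using (⌊log₂_⌋)
open import Data.Fin as Fin using (Fin)
open import Data.Bool using (Bool; true; false; if_then_else_)
open import Data.List using (List; []; _∷_)
open import Data.Product using (_×_; _,_; ∃-syntax; Σ)
open import Data.Integer using (+_)
open import Data.Rational as ℚ using (ℚ; 0ℚ; 1ℚ; ½; _/_)
open import Relation.Binary.PropositionalEquality using (_≡_)

data Ans : Set where
  low good high : Ans

rank : Ans → ℕ
rank low  = 0
rank good = 1
rank high = 2

_≤ᴬ_ : Ans → Ans → Set
a ≤ᴬ b = rank a ℕ.≤ rank b

record Dist : Set where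
  field
    p      : Ans → ℚ
    nonneg : ∀ a → 0ℚ ℚ.≤ p a
    total  : p low ℚ.+ p good ℚ.+ p high ≡ 1ℚ
open Dist public

-- Domain {1,…,N} is represented by Fin N (element k+1 ↦ index k).
-- A history of past calls: list of (query, answer), most recent first.
History : ℕ → Set
History N = List (Fin N × Ans)

Oracle : ℕ → Set
Oracle N = History N → Fin N → Dist

ninetyNine% : ℚ
ninetyNine% = + 99 / 100

-- Conviction + monotonicity: some non-decreasing f such that every call
-- answers f(i) with probability ≥ 99/100 conditioned on any past history.
UncertainComparator : {N : ℕ} → Oracle N → Set
UncertainComparator {N} A =
  Σ (Fin N → Ans) λ f →
    (∀ i j → i Fin.≤ j → f i ≤ᴬ f j) ×
    (∀ (h : History N) i → ninetyNine% ℚ.≤ p (A h i) (f i))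

InGoal : {N : ℕ} → Oracle N → Fin N → Set
InGoal {N} A i = ∀ (h : History N) → ninetyNine% ℚ.≤ p (A h i) good

Appeasable : {N : ℕ} → Oracle N → Set
Appeasable A = ∃[ i ] InGoal A i

data Alg (N : ℕ) : Set where
  out   : Fin N → Alg N
  abort : Alg N
  coin  : Alg N → Alg N → Alg N
  query : Fin N → (Ans → Alg N) → Alg N

calls : {N : ℕ} → Alg N → ℕ
calls (out _)     = 0
calls abort       = 0
calls (coin t u)  = calls t ⊔ calls u
calls (query _ k) = suc (calls (k low) ⊔ calls (k good) ⊔ calls (k high))

succProb : {N : ℕ} → Alg N → Oracle N → History N → (Fin N → Bool) → ℚ
succProb (out i)     A h G = if G i then 1ℚ else 0ℚ
succProb abort       A h G = 0ℚ
succProb (coin t u)  A h G = ½ ℚ.* (succProb t A h G ℚ.+ succProb u A h G)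
succProb (query i k) A h G =
  p (A h i) low  ℚ.* succProb (k low)  A ((i , low)  ∷ h) G ℚ.+
  p (A h i) good ℚ.* succProb (k good) A ((i , good) ∷ h) G ℚ.+
  p (A h i) high ℚ.* succProb (k high) A ((i , high) ∷ h) G

-- Noisy binary search with backtracking (Feige, Raghavan, Peleg and Upfal) on the dyadic
-- intervals of [0, 2^K - 1], where K = 1 + ⌊log₂ N⌋ and positions beyond N - 1 are clamped.
-- A step queries both ends of the current interval; unless they bracket the goal (left end
-- not high, right end not low) it backtracks to the parent interval, otherwise it queries the
-- midpoint and descends. The distance of a node to the goal (its height if it brackets the
-- goal, one more than its parent's distance otherwise) drops by one after a step answered
-- truthfully, which has probability at least 0.99³ ≥ 0.97 whatever the history, and grows by
-- at most one after any step. So γ + ρ^t (2^x - 1 - γ) bounds the failure probability of t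
-- steps started at distance x; after 2K + 3 steps from the root this is at most 1/3, and every
-- step makes at most 3 queries.
module Submission where

open import Defs
open import Data.Nat as ℕ using (ℕ; zero; suc)
import Data.Nat.Properties as ℕP
open import Data.Fin as Fin using (Fin; toℕ)
import Data.Fin.Properties as FinP
import Data.Rational.Properties as ℚP
open import Data.Bool using (Bool; true; false; if_then_else_)
open import Data.List using ([]; _∷_)
open import Data.Product using (Σ; ∃; ∃-syntax; _×_; _,_; proj₂)
open import Data.Unit using (⊤; tt)
open import Data.Empty using (⊥; ⊥-elim)
open import Data.Integer using (+_)
open import Data.Rational as ℚ using (ℚ; 0ℚ; 1ℚ; _/_)
open import Relation.Nullary using (Dec; yes; no; ¬_; does)
open import Relation.Nullary.Decidable using (_×-dec_)
open import Relation.Binary.PropositionalEquality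
open import Function.Bundles using (_⇔_; Equivalence)

mersenne : ℕ → ℕ
mersenne zero    = 0
mersenne (suc s) = suc (mersenne s ℕ.+ mersenne s)

data QTree (N : ℕ) (X : Set) : Set where
  leaf : X → QTree N X
  ask  : Fin N → (Ans → QTree N X) → QTree N X

module _ {N : ℕ} {X : Set} where

  graft : QTree N X → (X → Alg N) → Alg N
  graft (leaf x)  k = k x
  graft (ask i t) k = query i (λ a → graft (t a) k)

  truthfulLeaf : (Fin N → Ans) → QTree N X → X
  truthfulLeaf f (leaf x)  = x
  truthfulLeaf f (ask i t) = truthfulLeaf f (t (f i))

  AllLeaves : (X → Set) → QTree N X → Set
  AllLeaves P (leaf x)  = P x
  AllLeaves P (ask i t) = ∀ a → AllLeaves P (t a)

  Depth≤ : ℕ → QTree N X → Set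
  Depth≤ d       (leaf x)  = ⊤
  Depth≤ zero    (ask i t) = ⊥
  Depth≤ (suc d) (ask i t) = ∀ a → Depth≤ d (t a)

  AllLeaves-map : ∀ {P Q : X → Set} → (∀ {x} → P x → Q x) → ∀ t → AllLeaves P t → AllLeaves Q t
  AllLeaves-map P⇒Q (leaf x)  px  = P⇒Q px
  AllLeaves-map P⇒Q (ask i t) all = λ a → AllLeaves-map P⇒Q (t a) (all a)

  AllLeaves-truthful : ∀ {P} f (t : QTree N X) → AllLeaves P t → P (truthfulLeaf f t)
  AllLeaves-truthful f (leaf x)  px  = px
  AllLeaves-truthful f (ask i t) all = AllLeaves-truthful f (t (f i)) (all (f i))

  calls-graft : ∀ d (t : QTree N X) (k : X → Alg N) {c} → Depth≤ d t → (∀ x → calls (k x) ℕ.≤ c) →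
                calls (graft t k) ℕ.≤ d ℕ.+ c
  calls-graft d       (leaf x)  k {c} _       k≤c = ℕP.≤-trans (k≤c x) (ℕP.m≤n+m c d)
  calls-graft (suc d) (ask i t) k     shallow k≤c =
    ℕ.s≤s (ℕP.⊔-lub (ℕP.⊔-lub (subtree low) (subtree good)) (subtree high))
    where subtree = λ a → calls-graft d (t a) k (shallow a) k≤c

module _ where
  open import Data.Rational using (_+_; _*_; _-_; -_; _≤_; nonNegative)
  open import Data.Rational.Properties
  open import Data.Rational.Solver using (module +-*-Solver)

  infixr 8 _^_
  _^_ : ℚ → ℕ → ℚ
  q ^ zero  = 1ℚ
  q ^ suc n = q * q ^ n

  p≤p+q : ∀ {p q} → 0ℚ ≤ q → p ≤ p + q
  p≤p+q {p} 0≤q = ≤-trans (≤-reflexive (sym (+-identityʳ p))) (+-monoʳ-≤ p 0≤q)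

  p≤q⇒0≤q-p : ∀ {p q} → p ≤ q → 0ℚ ≤ q - p
  p≤q⇒0≤q-p {p} p≤q = ≤-trans (≤-reflexive (sym (+-inverseʳ p))) (+-monoˡ-≤ (- p) p≤q)

  p≤q⇒p-q≤0 : ∀ {p q} → p ≤ q → p - q ≤ 0ℚ
  p≤q⇒p-q≤0 {p} {q} p≤q = ≤-trans (+-monoˡ-≤ (- q) p≤q) (≤-reflexive (+-inverseʳ q))

  0≤p+q : ∀ {p q} → 0ℚ ≤ p → 0ℚ ≤ q → 0ℚ ≤ p + q
  0≤p+q 0≤p 0≤q = ≤-trans 0≤p (p≤p+q 0≤q)

  0≤p*q : ∀ {p q} → 0ℚ ≤ p → 0ℚ ≤ q → 0ℚ ≤ p * q
  0≤p*q {p} {q} 0≤p 0≤q =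
    nonNegative⁻¹ _ {{nonNeg*nonNeg⇒nonNeg p {{nonNegative 0≤p}} q {{nonNegative 0≤q}}}}

  *-monoˡ-≤-0≤ : ∀ {r p q} → 0ℚ ≤ r → p ≤ q → r * p ≤ r * q
  *-monoˡ-≤-0≤ {r} 0≤r = *-monoˡ-≤-nonNeg r {{nonNegative 0≤r}}

  *-monoʳ-≤-0≤ : ∀ {r p q} → 0ℚ ≤ r → p ≤ q → p * r ≤ q * r
  *-monoʳ-≤-0≤ {r} 0≤r = *-monoʳ-≤-nonNeg r {{nonNegative 0≤r}}

  0≤q^n : ∀ {q} → 0ℚ ≤ q → ∀ n → 0ℚ ≤ q ^ n
  0≤q^n 0≤q zero    = ≤ᵇ⇒≤ tt
  0≤q^n 0≤q (suc n) = 0≤p*q 0≤q (0≤q^n 0≤q n)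

  q^n≤1 : ∀ {q} → 0ℚ ≤ q → q ≤ 1ℚ → ∀ n → q ^ n ≤ 1ℚ
  q^n≤1     0≤q q≤1 zero    = ≤-refl
  q^n≤1 {q} 0≤q q≤1 (suc n) = begin
    q * q ^ n   ≤⟨ *-monoʳ-≤-0≤ (0≤q^n 0≤q n) q≤1 ⟩
    1ℚ * q ^ n  ≡⟨ *-identityˡ (q ^ n) ⟩
    q ^ n       ≤⟨ q^n≤1 0≤q q≤1 n ⟩
    1ℚ          ∎
    where open ≤-Reasoning

  m+w[s-m]≤s : ∀ {w m s} → w ≤ 1ℚ → m ≤ s → m + w * (s - m) ≤ s
  m+w[s-m]≤s {w} {m} {s} w≤1 m≤s = begin
    m + w * (s - m)   ≤⟨ +-monoʳ-≤ m (*-monoʳ-≤-0≤ (p≤q⇒0≤q-p m≤s) w≤1) ⟩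
    m + 1ℚ * (s - m)  ≡⟨ solve 2 (λ m s → m :+ con 1ℚ :* (s :- m) := s) refl m s ⟩
    s                 ∎
    where
    open ≤-Reasoning
    open +-*-Solver

  -- succProb (query i k) A h G is by definition expect (A h i) (λ a → succProb (k a) A ((i , a) ∷ h) G).
  expect : Dist → (Ans → ℚ) → ℚ
  expect D S = p D low * S low + p D good * S good + p D high * S high

  expect-≥ : ∀ D {S m} → (∀ a → m ≤ S a) → ∀ c → m + p D c * (S c - m) ≤ expect D S
  expect-≥ D {S} {m} m≤S c = begin
    m + excess c                        ≤⟨ +-monoʳ-≤ m (excess≤all c) ⟩
    m + allExcess                       ≡⟨ cong (_+ allExcess) (sym (*-identityˡ m)) ⟩
    1ℚ * m + allExcess                  ≡⟨ cong (λ z → z * m + allExcess) (sym (total D)) ⟩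
    (pl + pg + ph) * m + allExcess      ≡⟨ solve 7 (λ pl pg ph sl sg sh m →
        (pl :+ pg :+ ph) :* m :+ (pl :* (sl :- m) :+ pg :* (sg :- m) :+ ph :* (sh :- m))
          := pl :* sl :+ pg :* sg :+ ph :* sh) refl pl pg ph (S low) (S good) (S high) m ⟩
    expect D S                          ∎
    where
    open ≤-Reasoning
    open +-*-Solver
    pl = p D low
    pg = p D good
    ph = p D high
    excess : Ans → ℚ
    excess a = p D a * (S a - m)
    0≤excess : ∀ a → 0ℚ ≤ excess a
    0≤excess a = 0≤p*q (nonneg D a) (p≤q⇒0≤q-p (m≤S a))
    allExcess : ℚ
    allExcess = excess low + excess good + excess high
    excess≤all : ∀ a → excess a ≤ allExcess
    excess≤all low  = ≤-trans (≤-reflexive (solve 1 (λ e → e := e :+ con 0ℚ :+ con 0ℚ) refl (excess low)))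
      (+-mono-≤ (+-mono-≤ (≤-refl {excess low}) (0≤excess good)) (0≤excess high))
    excess≤all good = ≤-trans (≤-reflexive (solve 1 (λ e → e := con 0ℚ :+ e :+ con 0ℚ) refl (excess good)))
      (+-mono-≤ (+-mono-≤ (0≤excess low) (≤-refl {excess good})) (0≤excess high))
    excess≤all high = ≤-trans (≤-reflexive (solve 1 (λ e → e := con 0ℚ :+ con 0ℚ :+ e) refl (excess high)))
      (+-mono-≤ (+-mono-≤ (0≤excess low) (0≤excess good)) (≤-refl {excess high}))

  likely⇒good : ∀ D {c} → ninetyNine% ≤ p D c → ninetyNine% ≤ p D good → c ≡ good
  likely⇒good D {low}  c≥99% good≥99% =
    ⊥-elim (≤⇒≤ᵇ (≤-trans (+-mono-≤ (+-mono-≤ c≥99% good≥99%) (nonneg D high)) (≤-reflexive (total D))))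
  likely⇒good D {good} _ _ = refl
  likely⇒good D {high} c≥99% good≥99% =
    ⊥-elim (≤⇒≤ᵇ (≤-trans (+-mono-≤ (+-mono-≤ (nonneg D low) good≥99%) c≥99%) (≤-reflexive (total D))))

  module _ {N : ℕ} (A : Oracle N) (G : Fin N → Bool) (f : Fin N → Ans) {q : ℚ}
           (0≤q : 0ℚ ≤ q) (q≤1 : q ≤ 1ℚ) (truthful : ∀ h i → q ≤ p (A h i) (f i)) where

    succProb-graft : ∀ {X} d (t : QTree N X) (k : X → Alg N) {m s} → Depth≤ d t → m ≤ s →
      AllLeaves (λ x → ∀ h → m ≤ succProb (k x) A h G) t →
      (∀ h → s ≤ succProb (k (truthfulLeaf f t)) A h G) →
      ∀ h → m + q ^ d * (s - m) ≤ succProb (graft t k) A h G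
    succProb-graft d (leaf x) k _ m≤s _ s≤k h = ≤-trans (m+w[s-m]≤s (q^n≤1 0≤q q≤1 d) m≤s) (s≤k h)
    succProb-graft (suc d) (ask i t) k {m} {s} shallow m≤s all s≤k h = begin
      m + q * q ^ d * (s - m)        ≡⟨ solve 4 (λ m s q qd → m :+ q :* qd :* (s :- m)
                                          := m :+ q :* ((m :+ qd :* (s :- m)) :- m)) refl m s q (q ^ d) ⟩
      m + q * (s₁ - m)               ≤⟨ +-monoʳ-≤ m (*-monoʳ-≤-0≤ (p≤q⇒0≤q-p m≤s₁) (truthful h i)) ⟩
      m + p D (f i) * (s₁ - m)       ≤⟨ +-monoʳ-≤ m (*-monoˡ-≤-0≤ (nonneg D (f i)) (+-monoˡ-≤ (- m) s₁≤S)) ⟩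
      m + p D (f i) * (S (f i) - m)  ≤⟨ expect-≥ D m≤S (f i) ⟩
      expect D S                     ∎
      where
      open ≤-Reasoning
      open +-*-Solver
      D = A h i
      S : Ans → ℚ
      S a = succProb (graft (t a) k) A ((i , a) ∷ h) G
      s₁ = m + q ^ d * (s - m)
      m≤s₁ : m ≤ s₁
      m≤s₁ = p≤p+q (0≤p*q (0≤q^n 0≤q d) (p≤q⇒0≤q-p m≤s))
      s₁≤S : s₁ ≤ S (f i)
      s₁≤S = succProb-graft d (t (f i)) k (shallow (f i)) m≤s (all (f i)) s≤k _
      m≤S : ∀ a → m ≤ S a
      m≤S a = ≤-trans (≤-reflexive (solve 2 (λ m qd → m := m :+ qd :* (m :- m)) refl m (q ^ d)))
        (succProb-graft d (t a) k (shallow a) ≤-refl (all a) (AllLeaves-truthful f (t a) (all a)) _)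

  -- failBound-step needs 2ρ ≥ 1 + 9/100 at positive distance and γ (1 - ρ) ≥ 3/100 at distance 0
  -- (here with equality); ρ^2x*2^x≤1 needs 2ρ² ≤ 1, and γ + ρ³ ≤ 1/3 gives the final bound.
  ρ γ : ℚ
  ρ = + 5 / 8
  γ = + 2 / 25

  0≤ρ : 0ℚ ≤ ρ
  0≤ρ = ≤ᵇ⇒≤ tt

  mersenneℚ : ℕ → ℚ
  mersenneℚ zero    = 0ℚ
  mersenneℚ (suc x) = mersenneℚ x + mersenneℚ x + 1ℚ

  failBound : ℕ → ℕ → ℚ
  failBound x t = γ + ρ ^ t * (mersenneℚ x - γ)

  0≤mersenneℚ : ∀ x → 0ℚ ≤ mersenneℚ x
  0≤mersenneℚ zero    = ≤-refl
  0≤mersenneℚ (suc x) = 0≤p+q (0≤p+q (0≤mersenneℚ x) (0≤mersenneℚ x)) (≤ᵇ⇒≤ tt)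

  mersenneℚ-mono : ∀ {x y} → x ℕ.≤ y → mersenneℚ x ≤ mersenneℚ y
  mersenneℚ-mono {zero}  {y}     _           = 0≤mersenneℚ y
  mersenneℚ-mono {suc x} {suc y} (ℕ.s≤s x≤y) =
    +-monoˡ-≤ 1ℚ (+-mono-≤ (mersenneℚ-mono x≤y) (mersenneℚ-mono x≤y))

  failBound-mono : ∀ t {x y} → x ℕ.≤ y → failBound x t ≤ failBound y t
  failBound-mono t x≤y = +-monoʳ-≤ γ (*-monoˡ-≤-0≤ (0≤q^n 0≤ρ t) (+-monoˡ-≤ (- γ) (mersenneℚ-mono x≤y)))

  1≤failBound[1+x,0] : ∀ x → 1ℚ ≤ failBound (suc x) 0
  1≤failBound[1+x,0] x = begin
    1ℚ                                  ≤⟨ p≤p+q (0≤p+q (0≤mersenneℚ x) (0≤mersenneℚ x)) ⟩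
    1ℚ + (mersenneℚ x + mersenneℚ x)    ≡⟨ solve 1 (λ w → con 1ℚ :+ (w :+ w)
                                               := con γ :+ con 1ℚ :* ((w :+ w :+ con 1ℚ) :- con γ)) refl (mersenneℚ x) ⟩
    failBound (suc x) 0                 ∎
    where
    open ≤-Reasoning
    open +-*-Solver

  failBound-step : ∀ x t →
    failBound (x ℕ.∸ 1) t + + 3 / 100 * (failBound (suc x) t - failBound (x ℕ.∸ 1) t) ≤ failBound x (suc t)
  failBound-step zero t = ≤-reflexive (solve 1 (λ r →
      (con γ :+ r :* (con 0ℚ :- con γ))
        :+ con (+ 3 / 100) :* ((con γ :+ r :* (con 1ℚ :- con γ)) :- (con γ :+ r :* (con 0ℚ :- con γ)))
      := con γ :+ (con ρ :* r) :* (con 0ℚ :- con γ)) refl (ρ ^ t))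
    where open +-*-Solver
  failBound-step (suc x) t = begin
    lhs                                                     ≤⟨ p≤p+q (0≤p*q (0≤q^n 0≤ρ t) 0≤slack) ⟩
    lhs + ρ ^ t * (mersenneℚ x * (+ 4 / 25) + + 113 / 200)  ≡⟨ solve 2 (λ r w →
        (con γ :+ r :* (w :- con γ))
          :+ con (+ 3 / 100) :* ((con γ :+ r :* ((w :+ w :+ con 1ℚ) :+ (w :+ w :+ con 1ℚ) :+ con 1ℚ :- con γ))
                                 :- (con γ :+ r :* (w :- con γ)))
          :+ r :* (w :* con (+ 4 / 25) :+ con (+ 113 / 200))
        := con γ :+ (con ρ :* r) :* ((w :+ w :+ con 1ℚ) :- con γ)) refl (ρ ^ t) (mersenneℚ x) ⟩
    failBound (suc x) (suc t)                               ∎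
    where
    open ≤-Reasoning
    open +-*-Solver
    lhs = failBound x t + + 3 / 100 * (failBound (suc (suc x)) t - failBound x t)
    0≤slack : 0ℚ ≤ mersenneℚ x * (+ 4 / 25) + + 113 / 200
    0≤slack = 0≤p+q (0≤p*q (0≤mersenneℚ x) (≤ᵇ⇒≤ tt)) (≤ᵇ⇒≤ tt)

  ρ^2x*2^x≤1 : ∀ x → ρ ^ (x ℕ.+ x) * (mersenneℚ x + 1ℚ) ≤ 1ℚ
  ρ^2x*2^x≤1 zero = ≤ᵇ⇒≤ tt
  ρ^2x*2^x≤1 (suc x) rewrite ℕP.+-suc x x = begin
    ρ * (ρ * R) * (w + w + 1ℚ + 1ℚ)  ≡⟨ solve 2 (λ R w → con ρ :* (con ρ :* R) :* (w :+ w :+ con 1ℚ :+ con 1ℚ)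
                                          := con (+ 50 / 64) :* (R :* (w :+ con 1ℚ))) refl R w ⟩
    + 50 / 64 * (R * (w + 1ℚ))       ≤⟨ *-monoˡ-≤-0≤ (≤ᵇ⇒≤ tt) (ρ^2x*2^x≤1 x) ⟩
    + 50 / 64 * 1ℚ                   ≤⟨ ≤ᵇ⇒≤ tt ⟩
    1ℚ                               ∎
    where
    open ≤-Reasoning
    open +-*-Solver
    R = ρ ^ (x ℕ.+ x)
    w = mersenneℚ x

  rounds : ℕ → ℕ
  rounds K = 3 ℕ.+ (K ℕ.+ K)

  failBound-rounds : ∀ x → failBound x (rounds x) ≤ γ + ρ ^ 3
  failBound-rounds x = begin
    γ + ρ * (ρ * (ρ * R)) * (w - γ)  ≡⟨ cong (λ z → γ + z) (solve 2 (λ R v → con ρ :* (con ρ :* (con ρ :* R)) :* v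
                                          := con (ρ ^ 3) :* (R :* v)) refl R (w - γ)) ⟩
    γ + ρ ^ 3 * (R * (w - γ))        ≤⟨ +-monoʳ-≤ γ (*-monoˡ-≤-0≤ (0≤q^n 0≤ρ 3) R*[w-γ]≤1) ⟩
    γ + ρ ^ 3 * 1ℚ                   ≡⟨ cong (λ z → γ + z) (*-identityʳ (ρ ^ 3)) ⟩
    γ + ρ ^ 3                        ∎
    where
    open ≤-Reasoning
    open +-*-Solver
    R = ρ ^ (x ℕ.+ x)
    w = mersenneℚ x
    R*[w-γ]≤1 : R * (w - γ) ≤ 1ℚ
    R*[w-γ]≤1 = ≤-trans (*-monoˡ-≤-0≤ (0≤q^n 0≤ρ (x ℕ.+ x)) (+-monoʳ-≤ w (≤ᵇ⇒≤ tt))) (ρ^2x*2^x≤1 x)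

  2/3≤1-failBound[x,rounds[x]] : ∀ x → + 2 / 3 ≤ 1ℚ - failBound x (rounds x)
  2/3≤1-failBound[x,rounds[x]] x = ≤-trans (≤ᵇ⇒≤ tt) (+-monoʳ-≤ 1ℚ (neg-antimono-≤ (failBound-rounds x)))

Brackets : Ans → Ans → Set
Brackets x y = x ≤ᴬ good × good ≤ᴬ y

-- Opaque: otherwise `does (brackets? x y)` unfolds to a boolean test and `with brackets? x y`
-- can no longer abstract it.
opaque
  brackets? : ∀ x y → Dec (Brackets x y)
  brackets? x y = (rank x ℕ.≤? 1) ×-dec (1 ℕ.≤? rank y)

  good≤? : ∀ x → Dec (good ≤ᴬ x)
  good≤? x = 1 ℕ.≤? rank x

bracketed⇒good : ∀ {x} → Brackets x x → x ≡ good
bracketed⇒good {low}  (_ , ())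
bracketed⇒good {good} _ = refl
bracketed⇒good {high} (ℕ.s≤s () , _)

data Side : Set where
  left right : Side

towards : Ans → Side
towards c = if does (good≤? c) then left else right

module DyadicSearch {N : ℕ} (K : ℕ) (pos : ℕ → Fin N) where
  open import Data.Nat using (_+_; _*_; _≤_; _<_; _∸_; z≤n)
  open import Data.Nat.Properties

  -- A node of height s is the dyadic interval [lo p, lo p + 2^s - 1] of [0, 2^K - 1],
  -- given by its path from the root.
  data Node : ℕ → Set where
    root : Node K
    _◂_  : ∀ {s} → Side → Node (suc s) → Node s

  lo : ∀ {s} → Node s → ℕ
  lo root            = 0
  lo (left ◂ p)      = lo p
  lo {s} (right ◂ p) = lo p + suc (mersenne s)

  hi : ∀ {s} → Node s → ℕ
  hi {s} p = lo p + mersenne s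

  lo-right : ∀ {s} (p : Node (suc s)) → lo (right ◂ p) ≡ suc (hi (left ◂ p))
  lo-right {s} p = +-suc (lo p) (mersenne s)

  hi-right : ∀ {s} (p : Node (suc s)) → hi (right ◂ p) ≡ hi p
  hi-right {s} p = +-assoc (lo p) (suc (mersenne s)) (mersenne s)

  lo-◂ : ∀ {s} b (p : Node (suc s)) → lo p ≤ lo (b ◂ p)
  lo-◂ left  p = ≤-refl
  lo-◂ right p = m≤m+n (lo p) _

  hi-◂ : ∀ {s} b (p : Node (suc s)) → hi (b ◂ p) ≤ hi p
  hi-◂ {s} left  p = +-monoʳ-≤ (lo p) (m≤n⇒m≤1+n (m≤m+n (mersenne s) (mersenne s)))
  hi-◂     right p = ≤-reflexive (hi-right p)

  State : Set
  State = ∃ Node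

  parent : ∀ {s} → Node s → State
  parent root    = K , root
  parent (_ ◂ p) = _ , p

  descend : ∀ {s} → Node s → QTree N State
  descend {zero}  p = leaf (zero , p)
  descend {suc s} p = ask (pos (hi (left ◂ p))) (λ c → leaf (s , towards c ◂ p))

  step : State → QTree N State
  step (s , p) = ask (pos (lo p)) λ x → ask (pos (hi p)) λ y →
    if does (brackets? x y) then descend p else leaf (parent p)

  walk : State → ℕ → Alg N
  walk (_ , p) zero    = out (pos (lo p))
  walk v       (suc t) = graft (step v) (λ w → walk w t)

  step-depth : ∀ v → Depth≤ 3 (step v)
  step-depth (s , p) x y with brackets? x y
  step-depth (zero  , p) x y | yes _ = tt
  step-depth (suc s , p) x y | yes _ = λ _ → tt
  ... | no _ = tt

  calls-walk : ∀ v t → calls (walk v t) ≤ 3 * t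
  calls-walk v zero    = z≤n
  calls-walk v (suc t) = ≤-trans (calls-graft 3 (step v) (λ w → walk w t) (step-depth v) (λ w → calls-walk w t))
                                 (≤-reflexive (sym (*-suc 3 t)))

  module Distance (f : Fin N → Ans) (g-mono : ∀ {x y} → x ≤ y → f (pos x) ≤ᴬ f (pos y))
                  (a : ℕ) (g[a]≡good : f (pos a) ≡ good) (a≤hi[root] : a ≤ mersenne K) where

    g : ℕ → Ans
    g x = f (pos x)

    Consistent : ∀ {s} → Node s → Set
    Consistent p = Brackets (g (lo p)) (g (hi p))

    consistent? : ∀ {s} (p : Node s) → Dec (Consistent p)
    consistent? p = brackets? (g (lo p)) (g (hi p))

    distance : ∀ {s} → Node s → ℕ
    distance root        = K
    distance {s} (b ◂ p) = if does (consistent? (b ◂ p)) then s else suc (distance p)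

    consistent-root : Consistent root
    consistent-root = subst (g 0 ≤ᴬ_) g[a]≡good (g-mono z≤n) , subst (_≤ᴬ g (mersenne K)) g[a]≡good (g-mono a≤hi[root])

    consistent-parent : ∀ {s} b (p : Node (suc s)) → Consistent (b ◂ p) → Consistent p
    consistent-parent b p (lo≤good , good≤hi) =
      ≤-trans (g-mono (lo-◂ b p)) lo≤good , ≤-trans good≤hi (g-mono (hi-◂ b p))

    distance-consistent : ∀ {s} (p : Node s) → Consistent p → distance p ≡ s
    distance-consistent root    _ = refl
    distance-consistent (b ◂ p) c with consistent? (b ◂ p)
    ... | yes _ = refl
    ... | no ¬c = ⊥-elim (¬c c)

    distance-inconsistent : ∀ {s} b (p : Node (suc s)) → ¬ Consistent (b ◂ p) → distance (b ◂ p) ≡ suc (distance p)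
    distance-inconsistent b p ¬c with consistent? (b ◂ p)
    ... | yes c = ⊥-elim (¬c c)
    ... | no _  = refl

    distance-◂ : ∀ {s} b (p : Node (suc s)) → distance (b ◂ p) ≤ suc (distance p)
    distance-◂ {s} b p with consistent? (b ◂ p)
    ... | yes c rewrite distance-consistent p (consistent-parent b p c) = m≤n+m s 2
    ... | no _  = ≤-refl

    distance-parent : ∀ {s} (p : Node s) → distance (proj₂ (parent p)) ≤ suc (distance p)
    distance-parent root    = n≤1+n K
    distance-parent (b ◂ p) with consistent? (b ◂ p)
    ... | yes c rewrite distance-consistent p (consistent-parent b p c) = ≤-refl
    ... | no _  = m≤n+m (distance p) 2

    distance-step : ∀ {s} (p : Node s) → AllLeaves (λ v → distance (proj₂ v) ≤ suc (distance p)) (step (s , p))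
    distance-step p x y with brackets? x y
    distance-step {zero}  p x y | yes _ = n≤1+n (distance p)
    distance-step {suc s} p x y | yes _ = λ c → distance-◂ (towards c) p
    ... | no _ = distance-parent p

    distance-descend : ∀ {s} (p : Node s) → Consistent p → distance (proj₂ (truthfulLeaf f (descend p))) ≤ distance p ∸ 1
    distance-descend {zero}  p c rewrite distance-consistent p c = ≤-refl
    distance-descend {suc s} p c@(lo≤good , good≤hi) = ≤-reflexive (begin
      distance (towards (g mid) ◂ p)  ≡⟨ distance-consistent (towards (g mid) ◂ p) child-consistent ⟩
      s                               ≡⟨ cong (_∸ 1) (sym (distance-consistent p c)) ⟩
      distance p ∸ 1                  ∎)
      where
      open ≡-Reasoning
      mid = hi (left ◂ p)
      child-consistent : Consistent (towards (g mid) ◂ p)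
      child-consistent with good≤? (g mid)
      ... | yes good≤mid = lo≤good , good≤mid
      ... | no ¬good≤mid =
          subst (λ x → g x ≤ᴬ good) (sym (lo-right p)) (subst (g (suc mid) ≤ᴬ_) g[a]≡good (g-mono mid<a))
        , subst (λ x → good ≤ᴬ g x) (sym (hi-right p)) good≤hi
        where
        mid<a : mid < a
        mid<a = ≰⇒> λ a≤mid → ¬good≤mid (subst (_≤ᴬ g mid) g[a]≡good (g-mono a≤mid))

    distance-truthful : ∀ {s} (p : Node s) → distance (proj₂ (truthfulLeaf f (step (s , p)))) ≤ distance p ∸ 1
    distance-truthful p with consistent? p
    ... | yes c = distance-descend p c
    distance-truthful root    | no ¬c = ⊥-elim (¬c consistent-root)
    distance-truthful (b ◂ p) | no ¬c rewrite distance-inconsistent b p ¬c = ≤-refl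

    distance≡0⇒good : ∀ {s} (p : Node s) → distance p ≡ 0 → g (lo p) ≡ good
    distance≡0⇒good p d≡0 with consistent? p
    ... | yes c@(lo≤good , good≤hi) = bracketed⇒good (lo≤good , subst (λ x → good ≤ᴬ g x) hi≡lo good≤hi)
      where
      hi≡lo : hi p ≡ lo p
      hi≡lo = trans (cong (λ s → lo p + mersenne s) (trans (sym (distance-consistent p c)) d≡0)) (+-identityʳ (lo p))
    distance≡0⇒good root    d≡0 | no ¬c = ⊥-elim (¬c consistent-root)
    distance≡0⇒good (b ◂ p) d≡0 | no ¬c = ⊥-elim (1+n≢0 (trans (sym (distance-inconsistent b p ¬c)) d≡0))

module WalkAnalysis {N : ℕ} (K : ℕ) (pos : ℕ → Fin N)
    (f : Fin N → Ans) (g-mono : ∀ {x y} → x ℕ.≤ y → f (pos x) ≤ᴬ f (pos y))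
    (a : ℕ) (g[a]≡good : f (pos a) ≡ good) (a≤hi[root] : a ℕ.≤ mersenne K)
    (A : Oracle N) (G : Fin N → Bool) (truthful : ∀ h i → ninetyNine% ℚ.≤ p (A h i) (f i))
    (good⇒G : ∀ i → f i ≡ good → G i ≡ true) where
  open import Data.Rational using (_+_; _*_; _-_; -_; _≤_)
  open import Data.Rational.Properties
  open import Data.Rational.Solver using (module +-*-Solver)
  open DyadicSearch K pos
  open Distance f g-mono a g[a]≡good a≤hi[root]

  success : ℕ → ℕ → ℚ
  success x t = 1ℚ - failBound x t

  success-antitone : ∀ t {x y} → x ℕ.≤ y → success y t ≤ success x t
  success-antitone t x≤y = +-monoʳ-≤ 1ℚ (neg-antimono-≤ (failBound-mono t x≤y))

  0≤indicator : ∀ b → 0ℚ ≤ (if b then 1ℚ else 0ℚ)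
  0≤indicator true  = ≤ᵇ⇒≤ tt
  0≤indicator false = ≤-refl

  walk-succeeds : ∀ t v h → success (distance (proj₂ v)) t ≤ succProb (walk v t) A h G
  walk-succeeds zero (_ , p) h with distance p in eq
  ... | zero  rewrite good⇒G (pos (lo p)) (distance≡0⇒good p eq) = ≤ᵇ⇒≤ tt
  ... | suc x = ≤-trans (p≤q⇒p-q≤0 (1≤failBound[1+x,0] x)) (0≤indicator (G (pos (lo p))))
  walk-succeeds (suc t) v@(_ , p) h = begin
    success x (suc t)                       ≤⟨ +-monoʳ-≤ 1ℚ (neg-antimono-≤ (failBound-step x t)) ⟩
    1ℚ - (failBound (x ℕ.∸ 1) t + + 3 / 100 * (failBound (suc x) t - failBound (x ℕ.∸ 1) t))
                                            ≡⟨ solve 2 (λ b₋ b₊ → con 1ℚ :- (b₋ :+ con (+ 3 / 100) :* (b₊ :- b₋))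
                                                 := (con 1ℚ :- b₊) :+ con (+ 97 / 100) :* ((con 1ℚ :- b₋) :- (con 1ℚ :- b₊)))
                                                 refl (failBound (x ℕ.∸ 1) t) (failBound (suc x) t) ⟩
    sAll + + 97 / 100 * (sTrue - sAll)      ≤⟨ +-monoʳ-≤ sAll (*-monoʳ-≤-0≤ (p≤q⇒0≤q-p sAll≤sTrue) 97%≤99%³) ⟩
    sAll + ninetyNine% ^ 3 * (sTrue - sAll) ≤⟨ succProb-graft A G f (≤ᵇ⇒≤ tt) (≤ᵇ⇒≤ tt) truthful
                                                 3 (step v) (λ w → walk w t) (step-depth v) sAll≤sTrue leaves truth h ⟩
    succProb (walk v (suc t)) A h G         ∎
    where
    open ≤-Reasoning
    open +-*-Solver
    x = distance p
    sAll = success (suc x) t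
    sTrue = success (x ℕ.∸ 1) t
    97%≤99%³ : + 97 / 100 ≤ ninetyNine% ^ 3
    97%≤99%³ = ≤ᵇ⇒≤ tt
    sAll≤sTrue : sAll ≤ sTrue
    sAll≤sTrue = success-antitone t (ℕP.≤-trans (ℕP.m∸n≤m x 1) (ℕP.n≤1+n x))
    leaves : AllLeaves (λ w → ∀ h → sAll ≤ succProb (walk w t) A h G) (step v)
    leaves = AllLeaves-map (λ {w} d≤ h → ≤-trans (success-antitone t d≤) (walk-succeeds t w h)) (step v) (distance-step p)
    truth : ∀ h → sTrue ≤ succProb (walk (truthfulLeaf f (step v)) t) A h G
    truth h = ≤-trans (success-antitone t (distance-truthful p)) (walk-succeeds t _ h)

module _ where
  open import Data.Nat using (_+_; _*_; _≤_; _<_; _⊓_; s≤s)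
  open import Data.Nat.Properties
  open import Data.Nat.Logarithm using (⌊log₂_⌋; ⌊log₂⌋-mono-≤; ⌊log₂[2^n]⌋≡n)
  open import Data.Nat.Solver using (module +-*-Solver)

  2^n≡1+mersenne[n] : ∀ n → 2 ℕ.^ n ≡ suc (mersenne n)
  2^n≡1+mersenne[n] zero    = refl
  2^n≡1+mersenne[n] (suc n) = begin
    2 * 2 ℕ.^ n            ≡⟨ cong (2 *_) (2^n≡1+mersenne[n] n) ⟩
    2 * suc (mersenne n)   ≡⟨ solve 1 (λ m → con 2 :* (con 1 :+ m) := con 1 :+ (con 1 :+ (m :+ m))) refl (mersenne n) ⟩
    suc (mersenne (suc n)) ∎
    where
    open ≡-Reasoning
    open +-*-Solver

  n<2^[1+⌊log₂n⌋] : ∀ n → n < 2 ℕ.^ suc ⌊log₂ n ⌋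
  n<2^[1+⌊log₂n⌋] n = ≰⇒> λ 2^[1+⌊log₂n⌋]≤n →
    1+n≰n (subst (_≤ ⌊log₂ n ⌋) (⌊log₂[2^n]⌋≡n (suc ⌊log₂ n ⌋))
                 (⌊log₂⌋-mono-≤ 2^[1+⌊log₂n⌋]≤n))

  levels : ℕ → ℕ
  levels N = suc ⌊log₂ N ⌋

  n≤mersenne[levels[1+n]] : ∀ n → n ≤ mersenne (levels (suc n))
  n≤mersenne[levels[1+n]] n =
    <⇒≤ (ℕ.s<s⁻¹ (subst (suc n <_) (2^n≡1+mersenne[n] (levels (suc n))) (n<2^[1+⌊log₂n⌋] (suc n))))

  clamp : ∀ n → ℕ → Fin (suc n)
  clamp n x = Fin.fromℕ< (s≤s (m⊓n≤n x n))

  toℕ-clamp : ∀ n x → toℕ (clamp n x) ≡ x ⊓ n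
  toℕ-clamp n x = FinP.toℕ-fromℕ< _

  clamp-mono : ∀ n {x y} → x ≤ y → clamp n x Fin.≤ clamp n y
  clamp-mono n {x} {y} x≤y = subst₂ _≤_ (sym (toℕ-clamp n x)) (sym (toℕ-clamp n y)) (⊓-monoˡ-≤ n x≤y)

  clamp-toℕ : ∀ {n} (i : Fin (suc n)) → clamp n (toℕ i) ≡ i
  clamp-toℕ {n} i = FinP.toℕ-injective (trans (toℕ-clamp n (toℕ i)) (m≤n⇒m⊓n≡m (FinP.toℕ≤pred[n] i)))

  3*rounds[1+L]≤15*[1+L] : ∀ L → 3 * rounds (suc L) ≤ 15 * suc L
  3*rounds[1+L]≤15*[1+L] L = begin
    3 * rounds (suc L)  ≡⟨ solve 1 (λ L → con 3 :* (con 3 :+ ((con 1 :+ L) :+ (con 1 :+ L))) := con 15 :+ con 6 :* L) refl L ⟩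
    15 + 6 * L          ≤⟨ +-monoʳ-≤ 15 (*-monoˡ-≤ L (m≤m+n 6 9)) ⟩
    15 + 15 * L         ≡⟨ sym (*-suc 15 L) ⟩
    15 * suc L          ∎
    where
    open ≤-Reasoning
    open +-*-Solver

open import Data.Nat using (_*_; _≤_)
open import Data.Nat.Logarithm using (⌊log₂_⌋)

search : (N : ℕ) → Alg N
search zero    = abort
search (suc n) = walk (_ , root) (rounds (levels (suc n)))
  where open DyadicSearch (levels (suc n)) (clamp n)

calls-search : ∀ N → calls (search N) ≤ 15 * levels N
calls-search zero    = ℕ.z≤n
calls-search (suc n) = ℕP.≤-trans (calls-walk (_ , root) (rounds K)) (3*rounds[1+L]≤15*[1+L] ⌊log₂ suc n ⌋)
  where
  K = levels (suc n)
  open DyadicSearch K (clamp n)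

search-succeeds : ∀ N (A : Oracle N) → UncertainComparator A → Appeasable A →
  (G : Fin N → Bool) → (∀ i → (G i ≡ true) ⇔ InGoal A i) →
  (+ 2 / 3) ℚ.≤ succProb (search N) A [] G
search-succeeds zero    A _ (() , _)
search-succeeds (suc n) A (f , f-mono , truthful) (a , a∈goal) G G⇔goal =
  ℚP.≤-trans (2/3≤1-failBound[x,rounds[x]] K) (walk-succeeds (rounds K) (_ , root) [])
  where
  K = levels (suc n)
  f[a]≡good : f a ≡ good
  f[a]≡good = likely⇒good (A [] a) (truthful [] a) (a∈goal [])
  good⇒G : ∀ i → f i ≡ good → G i ≡ true
  good⇒G i f[i]≡good =
    Equivalence.from (G⇔goal i) λ h → subst (λ c → ninetyNine% ℚ.≤ p (A h i) c) f[i]≡good (truthful h i)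
  open DyadicSearch K (clamp n) using (root)
  g-mono : ∀ {x y} → x ≤ y → f (clamp n x) ≤ᴬ f (clamp n y)
  g-mono x≤y = f-mono _ _ (clamp-mono n x≤y)
  a≤mersenne[K] : toℕ a ≤ mersenne K
  a≤mersenne[K] = ℕP.≤-trans (FinP.toℕ≤pred[n] a) (n≤mersenne[levels[1+n]] n)
  open WalkAnalysis K (clamp n) f g-mono (toℕ a) (trans (cong f (clamp-toℕ a)) f[a]≡good) a≤mersenne[K]
                    A G truthful good⇒G

lemma7p4 : ∃[ C ] Σ ((N : ℕ) → Alg N) λ alg →
    (∀ N → calls (alg N) ≤ C * suc ⌊log₂ N ⌋) ×
    (∀ N (A : Oracle N) → UncertainComparator A → Appeasable A →
    (G : Fin N → Bool) → (∀ i → (G i ≡ true) ⇔ InGoal A i) →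
    (+ 2 / 3) ℚ.≤ succProb (alg N) A [] G)
lemma7p4 = 15 , search , calls-search , search-succeeds
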